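{- Let $G$ be a $!$-graph with $!$-vertices $b, c$ such that $B^\uparrow(b)\setminus\{b\} = B^\uparrow(c)\setminus\{c\}$ and $B(b)\cap B(c)=\varnothing$. Then $\mathrm{MERGE}_{b,c}(G)$ is a $!$-graph and $U(G) \cong U(\mathrm{MERGE}_{b,c}(G))$.
   Context: Fix a compressed monoidal signature $T=(O,M,\mathrm{dom},\mathrm{cod})$, $\mathrm{dom},\mathrm{cod}: M \rightarrow (O\times\{\mathsf{v},\mathsf{f}\})^*$. The derived compressed typegraph $\mathcal{G}_T$ has vertex set $O\sqcup M$, a self-loop on each $X\in O$, an edge $\mathrm{in}^a_{f,i}$ from $X$ to $f$ for each $f\in M$ and index $i$ with $\mathrm{dom}(f)[i]=(X,a)$, and an edge $\mathrm{out}^a_{f,j}$ from $f$ to $X$ for each index $j$ with $\mathrm{cod}(f)[j]=(X,a)$. $\mathcal{G}_{T!}$ is $\mathcal{G}_T$ plus a vertex $!$, a self-loop on $!$, and an edge from $!$ to each vertex of $\mathcal{G}_T$. For a finite directed multigraph $G$ typed over $\mathcal{G}_{T!}$, vertices typed in $O$, $M$, $!$ are wire-, node-, $!$-vertices; fixed-arity edges are those typed by an $\mathsf{f}$-tagged edge; $U$ deletes $!$-vertices and incident edges. A string graph is a $\mathcal{G}_T$-typed graph whose typing restricts at each node-vertex to a bijection on incident fixed-arity edges and whose wire-vertices have at most one incoming and one outgoing edge. An open subgraph $O'$ of a string graph $K$ is a string subgraph with no vertex adjacent to a wire-vertex outside $O'$ and no incident fixed-arity edge outside $O'$. For a $!$-vertex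 $b$, $B(b)$ is the full subgraph on the successors of $b$ and $B^\uparrow(b)$ the full subgraph on the predecessors of $b$ (both contain $b$); $\beta(G)$ is the full subgraph on $!$-vertices. A $!$-graph is a $\mathcal{G}_{T!}$-typed graph with $U(G)$ a string graph, $\beta(G)$ posetal (at most one edge between two vertices, edge relation a partial order), $U(B(b))$ open in $U(G)$ for each $!$-vertex $b$, and $B(b')\subseteq B(b)$ whenever $b'\in B(b)$. Under the stated hypotheses, $\mathrm{MERGE}_{b,c}(G)$ is defined as the coequaliser in $\mathbf{Graph}/\mathcal{G}_{T!}$ of the two morphisms $\widehat b, \widehat c : B^\uparrow(b) \rightarrow G$, where $\widehat b$ is the inclusion and $\widehat c$ is the inclusion of $B^\uparrow(c)$ into $G$ composed with the isomorphism $B^\uparrow(b)\cong B^\uparrow(c)$ that is the identity on $B^\uparrow(b)\setminus\{b\}$ and sends $b$ to $c$. -}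

module Defs where

open import Level using (0ℓ)
open import Data.Nat using (ℕ)
open import Data.Fin using (Fin; _≟_)
open import Data.Fin.Properties using (any?)
open import Data.List using (List; length; lookup)
open import Data.Product using (Σ; ∃; _×_; _,_; proj₁; proj₂)
open import Data.Sum using (_⊎_)
open import Data.Unit using (⊤; tt)
open import Data.Empty using (⊥)
open import Data.Bool using (T)
open import Relation.Nullary using (¬_; Dec; ⌊_⌋)
open import Relation.Nullary.Decidable using (_⊎-dec_; _×-dec_)
open import Relation.Binary.PropositionalEquality using (_≡_; _≢_; refl; sym; trans; cong; subst)
open import Function.Bundles using (_⇔_)

record Graph : Set₁ where
  field
    V E : Set
    src tgt : E → V
open Graph public

record GHom (G H : Graph) : Set where
  field
    fV : V G → V H
    fE : E G → E H
    src-comm : ∀ e → fV (src G e) ≡ src H (fE e)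
    tgt-comm : ∀ e → fV (tgt G e) ≡ tgt H (fE e)
open GHom public

record Typed (TG : Graph) : Set₁ where
  field
    graph  : Graph
    typing : GHom graph TG
open Typed public

module _ {TG : Graph} where
  Vt : Typed TG → Set
  Vt A = V (graph A)
  Et : Typed TG → Set
  Et A = E (graph A)
  srct : (A : Typed TG) → Et A → Vt A
  srct A = src (graph A)
  tgtt : (A : Typed TG) → Et A → Vt A
  tgtt A = tgt (graph A)
  τV : (A : Typed TG) → Vt A → V TG
  τV A = fV (typing A)
  τE : (A : Typed TG) → Et A → E TG
  τE A = fE (typing A)

  record THom (A B : Typed TG) : Set where
    field
      hom : GHom (graph A) (graph B)
      tyCommV : ∀ v → τV B (fV hom v) ≡ τV A v
      tyCommE : ∀ e → τE B (fE hom e) ≡ τE A e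
  open THom public

  mapV : {A B : Typed TG} → THom A B → Vt A → Vt B
  mapV h = fV (hom h)
  mapE : {A B : Typed TG} → THom A B → Et A → Et B
  mapE h = fE (hom h)

  _≈_ : {A B : Typed TG} → THom A B → THom A B → Set
  h ≈ k = (∀ v → mapV h v ≡ mapV k v) × (∀ e → mapE h e ≡ mapE k e)

  _∘H_ : {A B C : Typed TG} → THom B C → THom A B → THom A C
  _∘H_ {A} {B} {C} k h = record
    { hom = record
      { fV = λ v → mapV k (mapV h v)
      ; fE = λ e → mapE k (mapE h e)
      ; src-comm = λ e → trans (cong (mapV k) (src-comm (hom h) e)) (src-comm (hom k) (mapE h e))
      ; tgt-comm = λ e → trans (cong (mapV k) (tgt-comm (hom h) e)) (tgt-comm (hom k) (mapE h e)) }
    ; tyCommV = λ v → trans (tyCommV k (mapV h v)) (tyCommV h v)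
    ; tyCommE = λ e → trans (tyCommE k (mapE h e)) (tyCommE h e) }

  record _≅_ (A B : Typed TG) : Set where
    field
      to   : THom A B
      from : THom B A
      from∘to-V : ∀ v → mapV from (mapV to v) ≡ v
      from∘to-E : ∀ e → mapE from (mapE to e) ≡ e
      to∘from-V : ∀ v → mapV to (mapV from v) ≡ v
      to∘from-E : ∀ e → mapE to (mapE from e) ≡ e

  IsCoequaliser : {A G H : Typed TG} (f g : THom A G) (q : THom G H) → Set₁
  IsCoequaliser {A} {G} {H} f g q =
    ((q ∘H f) ≈ (q ∘H g)) ×
    ((K : Typed TG) (h : THom G K) → (h ∘H f) ≈ (h ∘H g) →
       Σ (THom H K) λ u → ((u ∘H q) ≈ h) ×
         ((u' : THom H K) → (u' ∘H q) ≈ h → u' ≈ u))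

data Tag : Set where
  𝔳 𝔣 : Tag

record Signature : Set₁ where
  field
    O M : Set
    dom cod : M → List (O × Tag)

module _ (Sig : Signature) where
  open Signature Sig

  data TVT : Set where
    wire : O → TVT
    node : M → TVT

  data TET : Set where
    loopE : O → TET
    inE   : (f : M) → Fin (length (dom f)) → TET
    outE  : (f : M) → Fin (length (cod f)) → TET

  srcT : TET → TVT
  srcT (loopE X) = wire X
  srcT (inE f i) = wire (proj₁ (lookup (dom f) i))
  srcT (outE f j) = node f

  tgtT : TET → TVT
  tgtT (loopE X) = wire X
  tgtT (inE f i) = node f
  tgtT (outE f j) = wire (proj₁ (lookup (cod f) j))

  𝒢T : Graph
  𝒢T = record { V = TVT ; E = TET ; src = srcT ; tgt = tgtT }

  data TV! : Set where
    ty   : TVT → TV!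
    bang : TV!

  data TE! : Set where
    tyE      : TET → TE!
    bangLoop : TE!
    bangTo   : TVT → TE!

  src! : TE! → TV!
  src! (tyE t) = ty (srcT t)
  src! bangLoop = bang
  src! (bangTo v) = bang

  tgt! : TE! → TV!
  tgt! (tyE t) = ty (tgtT t)
  tgt! bangLoop = bang
  tgt! (bangTo v) = ty v

  𝒢T! : Graph
  𝒢T! = record { V = TV! ; E = TE! ; src = src! ; tgt = tgt! }

  -- fixed-arity edges of 𝒢_T : those tagged 𝔣
  Fixed : TET → Set
  Fixed (loopE X) = ⊥
  Fixed (inE f i) = proj₂ (lookup (dom f) i) ≡ 𝔣
  Fixed (outE f j) = proj₂ (lookup (cod f) j) ≡ 𝔣

  IsWire : TVT → Set
  IsWire (wire X) = ⊤
  IsWire (node f) = ⊥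

  -- String graphs, string subgraphs, open subgraphs (for 𝒢_T-typed graphs)
  -- A (full) subgraph is given by a predicate P on vertices; its edges are
  -- the edges with both endpoints satisfying P.

  module _ (S : Typed 𝒢T) where
    EdgeIn : (Vt S → Set) → Et S → Set
    EdgeIn P e = P (srct S e) × P (tgtt S e)

    Inc : Vt S → Et S → Set
    Inc v e = (srct S e ≡ v) ⊎ (tgtt S e ≡ v)

    IncT : M → TET → Set
    IncT f t = (srcT t ≡ node f) ⊎ (tgtT t ≡ node f)

    IsStringSub : (Vt S → Set) → Set
    IsStringSub P =
      -- at each node-vertex the typing restricts to a bijection between
      -- incident fixed-arity edges (of the subgraph) and incident
      -- fixed-arity edges of 𝒢_T
      (∀ v f → P v → τV S v ≡ node f →
         (∀ e e' → EdgeIn P e → EdgeIn P e' → Inc v e → Inc v e' →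
            Fixed (τE S e) → Fixed (τE S e') → τE S e ≡ τE S e' → e ≡ e')
         × (∀ t → Fixed t → IncT f t →
              ∃ λ e → EdgeIn P e × Inc v e × τE S e ≡ t))
      ×
      (∀ v → P v → IsWire (τV S v) →
         (∀ e e' → EdgeIn P e → EdgeIn P e' →
            tgtt S e ≡ v → tgtt S e' ≡ v → e ≡ e')
         × (∀ e e' → EdgeIn P e → EdgeIn P e' →
            srct S e ≡ v → srct S e' ≡ v → e ≡ e'))

    IsStringGraph : Set
    IsStringGraph = IsStringSub (λ _ → ⊤)

    IsOpenSub : (Vt S → Set) → Set
    IsOpenSub P =
      IsStringSub P
      × (∀ v w → P v → IsWire (τV S w) → ¬ P w → ∀ e →
           ¬ (((srct S e ≡ v) × (tgtt S e ≡ w)) ⊎ ((srct S e ≡ w) × (tgtt S e ≡ v))))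
      × (∀ v e → P v → Inc v e → Fixed (τE S e) → EdgeIn P e)

  NotBang : TV! → Set
  NotBang (ty _) = ⊤
  NotBang bang = ⊥

  NotBangE : TE! → Set
  NotBangE (tyE _) = ⊤
  NotBangE bangLoop = ⊥
  NotBangE (bangTo _) = ⊥

  unTy : (x : TV!) → NotBang x → TVT
  unTy (ty v) _ = v

  unTyE : (t : TE!) → NotBangE t → TET
  unTyE (tyE t) _ = t

  nbSrc : (t : TE!) → NotBangE t → NotBang (src! t)
  nbSrc (tyE t) _ = tt

  nbTgt : (t : TE!) → NotBangE t → NotBang (tgt! t)
  nbTgt (tyE t) _ = tt

  lemSrc : (x : TV!) (t : TE!) (eq : x ≡ src! t) (p : NotBangE t) →
           unTy x (subst NotBang (sym eq) (nbSrc t p)) ≡ srcT (unTyE t p)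
  lemSrc _ (tyE t) refl tt = refl

  lemTgt : (x : TV!) (t : TE!) (eq : x ≡ tgt! t) (p : NotBangE t) →
           unTy x (subst NotBang (sym eq) (nbTgt t p)) ≡ tgtT (unTyE t p)
  lemTgt _ (tyE t) refl tt = refl

  -- an edge has no !-endpoint iff its type is an edge of 𝒢_T
  U : Typed 𝒢T! → Typed 𝒢T
  U A = record
    { graph = record
      { V = Σ (Vt A) λ v → NotBang (τV A v)
      ; E = Σ (Et A) λ e → NotBangE (τE A e)
      ; src = λ { (e , p) → srct A e , subst NotBang (sym (src-comm (typing A) e)) (nbSrc (τE A e) p) }
      ; tgt = λ { (e , p) → tgtt A e , subst NotBang (sym (tgt-comm (typing A) e)) (nbTgt (τE A e) p) } }
    ; typing = record
      { fV = λ { (v , p) → unTy (τV A v) p }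
      ; fE = λ { (e , p) → unTyE (τE A e) p }
      ; src-comm = λ { (e , p) → lemSrc (τV A (srct A e)) (τE A e) (src-comm (typing A) e) p }
      ; tgt-comm = λ { (e , p) → lemTgt (τV A (tgtt A e)) (τE A e) (tgt-comm (typing A) e) p } } }

  record FinGraph : Set where
    field
      n m : ℕ
      fsrc ftgt : Fin m → Fin n

  record FinTyped : Set where
    field
      fg : FinGraph
      ftyping : GHom (record { V = Fin (FinGraph.n fg) ; E = Fin (FinGraph.m fg)
                             ; src = FinGraph.fsrc fg ; tgt = FinGraph.ftgt fg }) 𝒢T!

  toTyped : FinTyped → Typed 𝒢T!
  toTyped F = record { graph = _ ; typing = FinTyped.ftyping F }

  module _ (G : FinTyped) where
    private
      A = toTyped G

    IsBangV : Vt A → Set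
    IsBangV v = τV A v ≡ bang

    Edge : Vt A → Vt A → Set
    Edge x y = ∃ λ e → (srct A e ≡ x) × (tgtt A e ≡ y)

    InB : Vt A → Vt A → Set
    InB b v = (v ≡ b) ⊎ Edge b v

    InB↑ : Vt A → Vt A → Set
    InB↑ b v = (v ≡ b) ⊎ Edge v b

    -- decision procedure for InB↑ (used to build B↑(b) with
    -- proof-irrelevant membership)
    inB↑? : (b v : Vt A) → Dec (InB↑ b v)
    inB↑? b v = (v ≟ b) ⊎-dec any? (λ e → (srct A e ≟ v) ×-dec (tgtt A e ≟ b))

    MemB↑ : Vt A → Vt A → Set
    MemB↑ b v = T ⌊ inB↑? b v ⌋

    B↑ : Vt A → Typed 𝒢T!
    B↑ b = record
      { graph = record
        { V = Σ (Vt A) (MemB↑ b)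
        ; E = Σ (Et A) (λ e → MemB↑ b (srct A e) × MemB↑ b (tgtt A e))
        ; src = λ { (e , p , q) → srct A e , p }
        ; tgt = λ { (e , p , q) → tgtt A e , q } }
      ; typing = record
        { fV = λ { (v , _) → τV A v }
        ; fE = λ { (e , _) → τE A e }
        ; src-comm = λ { (e , _) → src-comm (typing A) e }
        ; tgt-comm = λ { (e , _) → tgt-comm (typing A) e } } }

    incl↑ : (b : Vt A) → THom (B↑ b) A
    incl↑ b = record
      { hom = record
        { fV = proj₁
        ; fE = proj₁
        ; src-comm = λ _ → refl
        ; tgt-comm = λ _ → refl }
      ; tyCommV = λ _ → refl
      ; tyCommE = λ _ → refl }

    UB : Vt A → Vt (U A) → Set
    UB b (v , _) = InB b v

    IsBangGraph : Set
    IsBangGraph =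
      IsStringGraph (U A)
      × (∀ x y → IsBangV x → IsBangV y → ∀ e e' →
           srct A e ≡ x → tgtt A e ≡ y → srct A e' ≡ x → tgtt A e' ≡ y → e ≡ e')
      × (∀ x → IsBangV x → Edge x x)
      × (∀ x y → IsBangV x → IsBangV y → Edge x y → Edge y x → x ≡ y)
      × (∀ x y z → IsBangV x → IsBangV y → IsBangV z →
           Edge x y → Edge y z → Edge x z)
      × (∀ b → IsBangV b → IsOpenSub (U A) (UB b))
      × (∀ b b' → IsBangV b → IsBangV b' → InB b b' → ∀ v → InB b' v → InB b v)

module Submission where

-- Rather than reasoning about an arbitrary coequaliser, we build an explicit
-- cocone h = (r, rE) : G → K, where r collapses c onto b, rE sends each edge
-- of B↑(c) to its φ-preimage, and K is G with all endpoints passed through r.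
-- As q factors through K, the mediating u : H → K is a section of that
-- factorisation (coequaliser-section): q ∘ u = id and u ∘ q = (r, rE), so u
-- picks canonical representatives in G.  Since r and rE fix everything U
-- keeps, U(G) ≅ U(H).  The string-graph and open-box conditions transport
-- along this isomorphism (the merged box being the disjoint union of U(B(b))
-- and U(B(c))), and the order axioms of β(H) are checked on representatives
-- using `redirect`, which moves edges into b onto c and back.

open import Defs
open import Data.Product using (Σ; ∃; _×_; _,_; proj₁; proj₂)
open import Data.Sum using (_⊎_; inj₁; inj₂; swap)
open import Data.Empty using (⊥; ⊥-elim)
open import Data.Unit using (⊤; tt)
open import Data.Bool.Properties using (T-irrelevant; T?)
open import Data.Fin using (_≟_)
open import Relation.Nullary using (¬_; Dec; yes; no)
open import Relation.Nullary.Decidable using (toWitness; fromWitness; _×-dec_)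
open import Relation.Binary.PropositionalEquality using (_≡_; _≢_; refl; sym; trans; cong; subst; subst₂)
open import Function.Bundles using (_⇔_; Equivalence)

module _ {TG : Graph} where

  idT : (A : Typed TG) → THom A A
  idT A = record
    { hom = record { fV = λ v → v ; fE = λ e → e ; src-comm = λ _ → refl ; tgt-comm = λ _ → refl }
    ; tyCommV = λ _ → refl ; tyCommE = λ _ → refl }

  -- This exhibits a coequaliser as a retract of an explicit
  -- cocone, which is how MERGE is computed below.
  coequaliser-section : {X G H K : Typed TG} {f g : THom X G} {q : THom G H} →
    IsCoequaliser f g q → (h : THom G K) → (h ∘H f) ≈ (h ∘H g) →
    (k : THom K H) → (k ∘H h) ≈ q →
    Σ (THom H K) λ u → ((u ∘H q) ≈ h) × ((k ∘H u) ≈ idT H)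
  coequaliser-section {H = H} {K = K} {q = q} (q-coequalises , universal) h h-coequalises k kh≈q =
    u , uq≈h , ku≈id
    where
    mediating : Σ (THom H K) λ u → ((u ∘H q) ≈ h) × ((u' : THom H K) → (u' ∘H q) ≈ h → u' ≈ u)
    mediating = universal K h h-coequalises
    u : THom H K
    u = proj₁ mediating
    uq≈h : (u ∘H q) ≈ h
    uq≈h = proj₁ (proj₂ mediating)
    -- both k ∘ u and the identity factor q through itself, so they agree
    factors-q : (w : THom H H) → (w ∘H q) ≈ q → w ≈ proj₁ (universal H q q-coequalises)
    factors-q = proj₂ (proj₂ (universal H q q-coequalises))
    kuq≈q : ((k ∘H u) ∘H q) ≈ q
    kuq≈q = (λ v → trans (cong (mapV k) (proj₁ uq≈h v)) (proj₁ kh≈q v))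
          , (λ e → trans (cong (mapE k) (proj₂ uq≈h e)) (proj₂ kh≈q e))
    id-factors : (idT H ∘H q) ≈ q
    id-factors = (λ _ → refl) , (λ _ → refl)
    ku≈id : (k ∘H u) ≈ idT H
    ku≈id = (λ v → trans (proj₁ (factors-q (k ∘H u) kuq≈q) v) (sym (proj₁ (factors-q (idT H) id-factors) v)))
          , (λ e → trans (proj₂ (factors-q (k ∘H u) kuq≈q) e) (sym (proj₂ (factors-q (idT H) id-factors) e)))

module StringGraphs (Sig : Signature) where
  open Signature Sig using (M)

  NodeBijective : (S : Typed (𝒢T Sig)) → (Vt S → Set) → Vt S → M → Set
  NodeBijective S P v f =
    (∀ e e' → EdgeIn Sig S P e → EdgeIn Sig S P e' → Inc Sig S v e → Inc Sig S v e' →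
       Fixed Sig (τE S e) → Fixed Sig (τE S e') → τE S e ≡ τE S e' → e ≡ e')
    × (∀ t → Fixed Sig t → IncT Sig S f t → ∃ λ e → EdgeIn Sig S P e × Inc Sig S v e × τE S e ≡ t)

  WireLinear : (S : Typed (𝒢T Sig)) → (Vt S → Set) → Vt S → Set
  WireLinear S P v =
    (∀ e e' → EdgeIn Sig S P e → EdgeIn Sig S P e' → tgtt S e ≡ v → tgtt S e' ≡ v → e ≡ e')
    × (∀ e e' → EdgeIn Sig S P e → EdgeIn Sig S P e' → srct S e ≡ v → srct S e' ≡ v → e ≡ e')

  Joins : (S : Typed (𝒢T Sig)) → Et S → Vt S → Vt S → Set
  Joins S e v w = ((srct S e ≡ v) × (tgtt S e ≡ w)) ⊎ ((srct S e ≡ w) × (tgtt S e ≡ v))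

  module Transport {A B : Typed (𝒢T Sig)} (i : A ≅ B)
      (P : Vt A → Set) (P' : Vt B → Set)
      (P'⇒P : ∀ w → P' w → P (mapV (_≅_.from i) w))
      (P⇒P' : ∀ w → P (mapV (_≅_.from i) w) → P' w) where
    open _≅_ i

    from-src : ∀ e → srct A (mapE from e) ≡ mapV from (srct B e)
    from-src e = sym (src-comm (hom from) e)

    from-tgt : ∀ e → tgtt A (mapE from e) ≡ mapV from (tgtt B e)
    from-tgt e = sym (tgt-comm (hom from) e)

    from-to-src : ∀ e → mapV from (srct B (mapE to e)) ≡ srct A e
    from-to-src e = trans (cong (mapV from) (sym (src-comm (hom to) e))) (from∘to-V (srct A e))

    from-to-tgt : ∀ e → mapV from (tgtt B (mapE to e)) ≡ tgtt A e
    from-to-tgt e = trans (cong (mapV from) (sym (tgt-comm (hom to) e))) (from∘to-V (tgtt A e))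

    from-injective : ∀ e e' → mapE from e ≡ mapE from e' → e ≡ e'
    from-injective e e' eq = trans (sym (to∘from-E e)) (trans (cong (mapE to) eq) (to∘from-E e'))

    edgeIn-from : ∀ e → EdgeIn Sig B P' e → EdgeIn Sig A P (mapE from e)
    edgeIn-from e (p , p') = subst P (sym (from-src e)) (P'⇒P _ p) , subst P (sym (from-tgt e)) (P'⇒P _ p')

    edgeIn-to : ∀ e → EdgeIn Sig A P e → EdgeIn Sig B P' (mapE to e)
    edgeIn-to e (p , p') = P⇒P' _ (subst P (sym (from-to-src e)) p) , P⇒P' _ (subst P (sym (from-to-tgt e)) p')

    inc-from : ∀ v e → Inc Sig B v e → Inc Sig A (mapV from v) (mapE from e)
    inc-from v e (inj₁ s≡v) = inj₁ (trans (from-src e) (cong (mapV from) s≡v))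
    inc-from v e (inj₂ t≡v) = inj₂ (trans (from-tgt e) (cong (mapV from) t≡v))

    inc-to : ∀ v e → Inc Sig A (mapV from v) e → Inc Sig B v (mapE to e)
    inc-to v e (inj₁ s≡v) = inj₁ (trans (sym (src-comm (hom to) e)) (trans (cong (mapV to) s≡v) (to∘from-V v)))
    inc-to v e (inj₂ t≡v) = inj₂ (trans (sym (tgt-comm (hom to) e)) (trans (cong (mapV to) t≡v) (to∘from-V v)))

    fixed-from : ∀ e → Fixed Sig (τE B e) → Fixed Sig (τE A (mapE from e))
    fixed-from e = subst (Fixed Sig) (sym (tyCommE from e))

    wire-from : ∀ v → IsWire Sig (τV B v) → IsWire Sig (τV A (mapV from v))
    wire-from v = subst (IsWire Sig) (sym (tyCommV from v))

    node-bijective : ∀ v f → P' v → τV B v ≡ node f →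
      NodeBijective A P (mapV from v) f → NodeBijective B P' v f
    node-bijective v f pv v:f (injective , surjective) = injective' , surjective'
      where
      injective' : ∀ e e' → EdgeIn Sig B P' e → EdgeIn Sig B P' e' → Inc Sig B v e → Inc Sig B v e' →
        Fixed Sig (τE B e) → Fixed Sig (τE B e') → τE B e ≡ τE B e' → e ≡ e'
      injective' e e' ei ei' inc inc' fx fx' same-type =
        from-injective e e' (injective (mapE from e) (mapE from e') (edgeIn-from e ei) (edgeIn-from e' ei')
          (inc-from v e inc) (inc-from v e' inc') (fixed-from e fx) (fixed-from e' fx')
          (trans (tyCommE from e) (trans same-type (sym (tyCommE from e')))))
      surjective' : ∀ t → Fixed Sig t → IncT Sig B f t → ∃ λ e → EdgeIn Sig B P' e × Inc Sig B v e × τE B e ≡ t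
      surjective' t fx inc with surjective t fx inc
      ... | e , ei , inc-e , e:t = mapE to e , edgeIn-to e ei , inc-to v e inc-e , trans (tyCommE to e) e:t

    wire-linear : ∀ v → WireLinear A P (mapV from v) → WireLinear B P' v
    wire-linear v (incoming , outgoing) =
        (λ e e' ei ei' t≡v t'≡v → from-injective e e' (incoming (mapE from e) (mapE from e')
           (edgeIn-from e ei) (edgeIn-from e' ei') (trans (from-tgt e) (cong (mapV from) t≡v))
           (trans (from-tgt e') (cong (mapV from) t'≡v))))
      , (λ e e' ei ei' s≡v s'≡v → from-injective e e' (outgoing (mapE from e) (mapE from e')
           (edgeIn-from e ei) (edgeIn-from e' ei') (trans (from-src e) (cong (mapV from) s≡v))
           (trans (from-src e') (cong (mapV from) s'≡v))))

    string-sub : IsStringSub Sig A P → IsStringSub Sig B P'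
    string-sub (nodes , wires) =
        (λ v f pv v:f → node-bijective v f pv v:f (nodes (mapV from v) f (P'⇒P v pv) (trans (tyCommV from v) v:f)))
      , (λ v pv w → wire-linear v (wires (mapV from v) (P'⇒P v pv) (wire-from v w)))

    joins-from : ∀ e v w → Joins B e v w → Joins A (mapE from e) (mapV from v) (mapV from w)
    joins-from e v w (inj₁ (s≡v , t≡w)) =
      inj₁ (trans (from-src e) (cong (mapV from) s≡v) , trans (from-tgt e) (cong (mapV from) t≡w))
    joins-from e v w (inj₂ (s≡w , t≡v)) =
      inj₂ (trans (from-src e) (cong (mapV from) s≡w) , trans (from-tgt e) (cong (mapV from) t≡v))

    open-sub : IsOpenSub Sig A P → IsOpenSub Sig B P'
    open-sub (string , separated , fixed-closed) = string-sub string , separated' , fixed-closed'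
      where
      separated' : ∀ v w → P' v → IsWire Sig (τV B w) → ¬ P' w → ∀ e → ¬ Joins B e v w
      separated' v w pv ww ¬pw e joins =
        separated (mapV from v) (mapV from w) (P'⇒P v pv) (wire-from w ww) (λ p → ¬pw (P⇒P' w p))
          (mapE from e) (joins-from e v w joins)
      fixed-closed' : ∀ v e → P' v → Inc Sig B v e → Fixed Sig (τE B e) → EdgeIn Sig B P' e
      fixed-closed' v e pv inc fx with fixed-closed (mapV from v) (mapE from e) (P'⇒P v pv) (inc-from v e inc) (fixed-from e fx)
      ... | ps , pt = P⇒P' _ (subst P (from-src e) ps) , P⇒P' _ (subst P (from-tgt e) pt)

  -- A node of an open subgraph R keeps its bijectivity in any larger
  -- subgraph R': its fixed-arity edges all lie in R already.
  node-in-larger : (S : Typed (𝒢T Sig)) (R R' : Vt S → Set) → (∀ w → R w → R' w) →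
    IsOpenSub Sig S R → ∀ v f → R v → τV S v ≡ node f → NodeBijective S R' v f
  node-in-larger S R R' R⊆R' ((nodes , _) , _ , fixed-closed) v f rv v:f = injective , surjective
    where
    injective : ∀ e e' → EdgeIn Sig S R' e → EdgeIn Sig S R' e' → Inc Sig S v e → Inc Sig S v e' →
      Fixed Sig (τE S e) → Fixed Sig (τE S e') → τE S e ≡ τE S e' → e ≡ e'
    injective e e' _ _ inc inc' fx fx' =
      proj₁ (nodes v f rv v:f) e e' (fixed-closed v e rv inc fx) (fixed-closed v e' rv inc' fx') inc inc' fx fx'
    surjective : ∀ t → Fixed Sig t → IncT Sig S f t → ∃ λ e → EdgeIn Sig S R' e × Inc Sig S v e × τE S e ≡ t
    surjective t fx inc with proj₂ (nodes v f rv v:f) t fx inc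
    ... | e , (rs , rt) , inc-e , e:t = e , (R⊆R' _ rs , R⊆R' _ rt) , inc-e , e:t

  wire-in-larger : (S : Typed (𝒢T Sig)) (R R' : Vt S → Set) → ∀ v →
    (∀ e → EdgeIn Sig S R' e → Inc Sig S v e → EdgeIn Sig S R e) →
    WireLinear S R v → WireLinear S R' v
  wire-in-larger S R R' v into-R (incoming , outgoing) =
      (λ e e' ei ei' t≡v t'≡v → incoming e e' (into-R e ei (inj₂ t≡v)) (into-R e' ei' (inj₂ t'≡v)) t≡v t'≡v)
    , (λ e e' ei ei' s≡v s'≡v → outgoing e e' (into-R e ei (inj₁ s≡v)) (into-R e' ei' (inj₁ s'≡v)) s≡v s'≡v)

  -- Let P and Q be disjoint and Q open.  An edge of P ∪ Q at a wire-vertex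
  -- v of P lies in P: otherwise it would join Q to v, which is outside Q.
  wire-edge-stays : (S : Typed (𝒢T Sig)) (P Q : Vt S → Set) → (∀ w → P w → Q w → ⊥) →
    IsOpenSub Sig S Q → ∀ v → P v → IsWire Sig (τV S v) →
    ∀ e → EdgeIn Sig S (λ w → P w ⊎ Q w) e → Inc Sig S v e → EdgeIn Sig S P e
  wire-edge-stays S P Q disjoint (_ , separated , _) v pv v-wire e (_ , inj₁ pt) (inj₁ s≡v) =
    subst P (sym s≡v) pv , pt
  wire-edge-stays S P Q disjoint (_ , separated , _) v pv v-wire e (_ , inj₂ qt) (inj₁ s≡v) =
    ⊥-elim (separated _ v qt v-wire (disjoint v pv) e (inj₂ (s≡v , refl)))
  wire-edge-stays S P Q disjoint (_ , separated , _) v pv v-wire e (inj₁ ps , _) (inj₂ t≡v) =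
    ps , subst P (sym t≡v) pv
  wire-edge-stays S P Q disjoint (_ , separated , _) v pv v-wire e (inj₂ qs , _) (inj₂ t≡v) =
    ⊥-elim (separated _ v qs v-wire (disjoint v pv) e (inj₁ (refl , t≡v)))

  union-open : (S : Typed (𝒢T Sig)) (P Q : Vt S → Set) → (∀ w → P w → Q w → ⊥) →
    IsOpenSub Sig S P → IsOpenSub Sig S Q → IsOpenSub Sig S (λ w → P w ⊎ Q w)
  union-open S P Q disjoint oP oQ = (nodes , wires) , separated , fixed-closed
    where
    PQ : Vt S → Set
    PQ w = P w ⊎ Q w
    nodes : ∀ v f → PQ v → τV S v ≡ node f → NodeBijective S PQ v f
    nodes v f (inj₁ pv) = node-in-larger S P PQ (λ _ → inj₁) oP v f pv
    nodes v f (inj₂ qv) = node-in-larger S Q PQ (λ _ → inj₂) oQ v f qv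
    wires : ∀ v → PQ v → IsWire Sig (τV S v) → WireLinear S PQ v
    wires v (inj₁ pv) v-wire = wire-in-larger S P PQ v
      (wire-edge-stays S P Q disjoint oQ v pv v-wire) (proj₂ (proj₁ oP) v pv v-wire)
    wires v (inj₂ qv) v-wire = wire-in-larger S Q PQ v
      (λ e (ps , pt) → wire-edge-stays S Q P (λ w q p → disjoint w p q) oP v qv v-wire e (swap ps , swap pt))
      (proj₂ (proj₁ oQ) v qv v-wire)
    separated : ∀ v w → PQ v → IsWire Sig (τV S w) → ¬ PQ w → ∀ e → ¬ Joins S e v w
    separated v w (inj₁ pv) ww ¬pq = proj₁ (proj₂ oP) v w pv ww (λ p → ¬pq (inj₁ p))
    separated v w (inj₂ qv) ww ¬pq = proj₁ (proj₂ oQ) v w qv ww (λ q → ¬pq (inj₂ q))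
    fixed-closed : ∀ v e → PQ v → Inc Sig S v e → Fixed Sig (τE S e) → EdgeIn Sig S PQ e
    fixed-closed v e (inj₁ pv) inc fx with proj₂ (proj₂ oP) v e pv inc fx
    ... | ps , pt = inj₁ ps , inj₁ pt
    fixed-closed v e (inj₂ qv) inc fx with proj₂ (proj₂ oQ) v e qv inc fx
    ... | qs , qt = inj₂ qs , inj₂ qt

module Forgetful (Sig : Signature) where

  NotBang-irrelevant : ∀ k (p p' : NotBang Sig k) → p ≡ p'
  NotBang-irrelevant (ty _) tt tt = refl

  NotBangE-irrelevant : ∀ k (p p' : NotBangE Sig k) → p ≡ p'
  NotBangE-irrelevant (tyE _) tt tt = refl

  U-vertex≡ : (X : Typed (𝒢T! Sig)) {x y : Vt X} {p : NotBang Sig (τV X x)} {p' : NotBang Sig (τV X y)} →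
    x ≡ y → _≡_ {A = Vt (U Sig X)} (x , p) (y , p')
  U-vertex≡ X {x} {p = p} {p'} refl = cong (x ,_) (NotBang-irrelevant _ p p')

  U-edge≡ : (X : Typed (𝒢T! Sig)) {e e' : Et X} {p : NotBangE Sig (τE X e)} {p' : NotBangE Sig (τE X e')} →
    e ≡ e' → _≡_ {A = Et (U Sig X)} (e , p) (e' , p')
  U-edge≡ X {e} {p = p} {p'} refl = cong (e ,_) (NotBangE-irrelevant _ p p')

  unTy-cong : ∀ {k k'} {p : NotBang Sig k} {p' : NotBang Sig k'} → k ≡ k' → unTy Sig k p ≡ unTy Sig k' p'
  unTy-cong {k} {p = p} {p'} refl = cong (unTy Sig k) (NotBang-irrelevant k p p')

  unTyE-cong : ∀ {k k'} {p : NotBangE Sig k} {p' : NotBangE Sig k'} → k ≡ k' → unTyE Sig k p ≡ unTyE Sig k' p'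
  unTyE-cong {k} {p = p} {p'} refl = cong (unTyE Sig k) (NotBangE-irrelevant k p p')

  U-hom : {A B : Typed (𝒢T! Sig)} (fv : Vt A → Vt B) (fe : Et A → Et B) →
    (∀ v → τV B (fv v) ≡ τV A v) → (∀ e → τE B (fe e) ≡ τE A e) →
    (∀ e → NotBangE Sig (τE A e) → fv (srct A e) ≡ srct B (fe e)) →
    (∀ e → NotBangE Sig (τE A e) → fv (tgtt A e) ≡ tgtt B (fe e)) →
    THom (U Sig A) (U Sig B)
  U-hom {A} {B} fv fe v-type e-type src tgt = record
    { hom = record
      { fV = λ { (v , p) → fv v , subst (NotBang Sig) (sym (v-type v)) p }
      ; fE = λ { (e , p) → fe e , subst (NotBangE Sig) (sym (e-type e)) p }
      ; src-comm = λ { (e , p) → U-vertex≡ B (src e p) }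
      ; tgt-comm = λ { (e , p) → U-vertex≡ B (tgt e p) } }
    ; tyCommV = λ { (v , p) → unTy-cong (v-type v) }
    ; tyCommE = λ { (e , p) → unTyE-cong (e-type e) } }

  -- In 𝒢_{T!} the only edge into ! is the loop on !, which U deletes;
  -- the edges U keeps have no endpoint !.
  into-bang-from-bang : ∀ k → tgt! Sig k ≡ bang → src! Sig k ≡ bang
  into-bang-from-bang bangLoop _ = refl

  into-bang-deleted : ∀ k → tgt! Sig k ≡ bang → ¬ NotBangE Sig k
  into-bang-deleted bangLoop _ ()

  kept-src-not-bang : ∀ k → NotBangE Sig k → src! Sig k ≢ bang
  kept-src-not-bang (tyE _) _ ()

  kept-tgt-not-bang : ∀ k → NotBangE Sig k → tgt! Sig k ≢ bang
  kept-tgt-not-bang (tyE _) _ ()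

module BangAxioms (Sig : Signature) (X : FinTyped Sig) where
  private
    A : Typed (𝒢T! Sig)
    A = toTyped Sig X

  β-Unique : Set
  β-Unique = ∀ x y → IsBangV Sig X x → IsBangV Sig X y → ∀ e e' →
    srct A e ≡ x → tgtt A e ≡ y → srct A e' ≡ x → tgtt A e' ≡ y → e ≡ e'

  β-Reflexive : Set
  β-Reflexive = ∀ x → IsBangV Sig X x → Edge Sig X x x

  β-Antisymmetric : Set
  β-Antisymmetric = ∀ x y → IsBangV Sig X x → IsBangV Sig X y → Edge Sig X x y → Edge Sig X y x → x ≡ y

  β-Transitive : Set
  β-Transitive = ∀ x y z → IsBangV Sig X x → IsBangV Sig X y → IsBangV Sig X z →
    Edge Sig X x y → Edge Sig X y z → Edge Sig X x z

  Boxes-Open : Set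
  Boxes-Open = ∀ b → IsBangV Sig X b → IsOpenSub Sig (U Sig A) (UB Sig X b)

  Boxes-Nested : Set
  Boxes-Nested = ∀ b b' → IsBangV Sig X b → IsBangV Sig X b' → InB Sig X b b' → ∀ v → InB Sig X b' v → InB Sig X b v

module Merge (Sig : Signature) (G : FinTyped Sig)
  (string-G : IsStringGraph Sig (U Sig (toTyped Sig G)))
  (unique-G : BangAxioms.β-Unique Sig G)
  (reflexive-G : BangAxioms.β-Reflexive Sig G)
  (antisymmetric-G : BangAxioms.β-Antisymmetric Sig G)
  (transitive-G : BangAxioms.β-Transitive Sig G)
  (open-G : BangAxioms.Boxes-Open Sig G)
  (nested-G : BangAxioms.Boxes-Nested Sig G)
  (b c : Vt (toTyped Sig G)) (b-bang : IsBangV Sig G b) (c-bang : IsBangV Sig G c)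
  (same-parents : ∀ v → ((v ≢ b) × InB↑ Sig G b v) ⇔ ((v ≢ c) × InB↑ Sig G c v))
  (disjoint : ∀ v → ¬ (InB Sig G b v × InB Sig G c v))
  (φ : B↑ Sig G b ≅ B↑ Sig G c)
  (φ-b : ∀ v → proj₁ v ≡ b → proj₁ (mapV (_≅_.to φ) v) ≡ c)
  (φ-fixV : ∀ v → proj₁ v ≢ b → proj₁ (mapV (_≅_.to φ) v) ≡ proj₁ v)
  (φ-fixE : ∀ e → srct (toTyped Sig G) (proj₁ e) ≢ b → tgtt (toTyped Sig G) (proj₁ e) ≢ b →
     proj₁ (mapE (_≅_.to φ) e) ≡ proj₁ e)
  (H : FinTyped Sig) (q : THom (toTyped Sig G) (toTyped Sig H))
  (q-coequaliser : IsCoequaliser (incl↑ Sig G b) (incl↑ Sig G c ∘H _≅_.to φ) q) where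

  open _≅_ φ
  open StringGraphs Sig
  open Forgetful Sig

  A : Typed (𝒢T! Sig)
  A = toTyped Sig G

  HA : Typed (𝒢T! Sig)
  HA = toTyped Sig H

  VG : Set
  VG = Vt A

  EG : Set
  EG = Et A

  s t : EG → VG
  s = srct A
  t = tgtt A

  τ : VG → TV! Sig
  τ = τV A

  Mem : VG → VG → Set
  Mem = MemB↑ Sig G

  mem⇒in : ∀ x v → Mem x v → InB↑ Sig G x v
  mem⇒in x v = toWitness {a? = inB↑? Sig G x v}

  in⇒mem : ∀ x v → InB↑ Sig G x v → Mem x v
  in⇒mem x v = fromWitness {a? = inB↑? Sig G x v}

  b≢c : b ≢ c
  b≢c b≡c = disjoint b (inj₁ refl , inj₁ b≡c)

  no-edge-b-c : ¬ Edge Sig G b c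
  no-edge-b-c e = disjoint c (inj₂ e , inj₁ refl)

  no-edge-c-b : ¬ Edge Sig G c b
  no-edge-c-b e = disjoint b (inj₁ refl , inj₂ e)

  c∉B↑b : ¬ Mem b c
  c∉B↑b m with mem⇒in b c m
  ... | inj₁ c≡b = b≢c (sym c≡b)
  ... | inj₂ e = no-edge-c-b e

  b∉B↑c : ¬ Mem c b
  b∉B↑c m with mem⇒in c b m
  ... | inj₁ b≡c = b≢c b≡c
  ... | inj₂ e = no-edge-b-c e

  parent-b⇒parent-c : ∀ x → Edge Sig G x b → x ≢ b → Edge Sig G x c
  parent-b⇒parent-c x e x≢b with Equivalence.to (same-parents x) (x≢b , inj₂ e)
  ... | x≢c , inj₁ x≡c = ⊥-elim (x≢c x≡c)
  ... | _ , inj₂ e' = e'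

  parent-c⇒parent-b : ∀ x → Edge Sig G x c → x ≢ c → Edge Sig G x b
  parent-c⇒parent-b x e x≢c with Equivalence.from (same-parents x) (x≢c , inj₂ e)
  ... | x≢b , inj₁ x≡b = ⊥-elim (x≢b x≡b)
  ... | _ , inj₂ e' = e'

  B↑-bang : ∀ x v → τ x ≡ bang → InB↑ Sig G x v → τ v ≡ bang
  B↑-bang x v x-bang (inj₁ refl) = x-bang
  B↑-bang x v x-bang (inj₂ (e , refl , refl)) =
    trans (src-comm (typing A) e) (into-bang-from-bang (τE A e) (trans (sym (tgt-comm (typing A) e)) x-bang))

  r : VG → VG
  r x with x ≟ c
  ... | yes _ = b
  ... | no _ = x

  r-c : r c ≡ b
  r-c with c ≟ c
  ... | yes _ = refl
  ... | no c≢c = ⊥-elim (c≢c refl)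

  r-other : ∀ x → x ≢ c → r x ≡ x
  r-other x x≢c with x ≟ c
  ... | yes x≡c = ⊥-elim (x≢c x≡c)
  ... | no _ = refl

  r-b : r b ≡ b
  r-b = r-other b b≢c

  r≢c : ∀ x → r x ≢ c
  r≢c x with x ≟ c
  ... | yes _ = b≢c
  ... | no x≢c = x≢c

  r-idempotent : ∀ x → r (r x) ≡ r x
  r-idempotent x = r-other (r x) (r≢c x)

  r-type : ∀ x → τ (r x) ≡ τ x
  r-type x with x ≟ c
  ... | yes refl = trans b-bang (sym c-bang)
  ... | no _ = refl

  r-fibres : ∀ x y → r x ≡ r y → (x ≡ y) ⊎ ((x ≡ b × y ≡ c) ⊎ (x ≡ c × y ≡ b))
  r-fibres x y rx≡ry with x ≟ c | y ≟ c
  ... | yes x≡c | yes y≡c = inj₁ (trans x≡c (sym y≡c))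
  ... | yes x≡c | no _ = inj₂ (inj₂ (x≡c , sym rx≡ry))
  ... | no _ | yes y≡c = inj₂ (inj₁ (rx≡ry , y≡c))
  ... | no _ | no _ = inj₁ rx≡ry

  r-injective-off-c : ∀ x y → x ≢ c → y ≢ c → r x ≡ r y → x ≡ y
  r-injective-off-c x y x≢c y≢c rx≡ry = trans (sym (r-other x x≢c)) (trans rx≡ry (r-other y y≢c))

  -- An edge into b can be redirected into c unless it starts at b, and
  -- conversely: this is where the hypothesis on the parents enters.
  redirect-b→c : ∀ x → Edge Sig G x b → (r x ≡ r c) ⊎ Edge Sig G x c
  redirect-b→c x e with x ≟ b
  ... | yes x≡b = inj₁ (trans (cong r x≡b) (trans r-b (sym r-c)))
  ... | no x≢b = inj₂ (parent-b⇒parent-c x e x≢b)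

  redirect-c→b : ∀ x → Edge Sig G x c → (r x ≡ r b) ⊎ Edge Sig G x b
  redirect-c→b x e with x ≟ c
  ... | yes _ = inj₁ (sym r-b)
  ... | no x≢c = inj₂ (parent-c⇒parent-b x e x≢c)

  redirect : ∀ x y y' → Edge Sig G x y → r y ≡ r y' → (r x ≡ r y') ⊎ Edge Sig G x y'
  redirect x y y' e ry≡ry' with r-fibres y y' ry≡ry'
  ... | inj₁ refl = inj₂ e
  ... | inj₂ (inj₁ (refl , refl)) = redirect-b→c x e
  ... | inj₂ (inj₂ (refl , refl)) = redirect-c→b x e

  from-vertex : ∀ y → proj₁ (mapV from y) ≡ r (proj₁ y)
  from-vertex y with proj₁ (mapV from y) ≟ b
  ... | yes from-y≡b = trans from-y≡b (sym (trans (cong r y≡c) r-c))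
    where
    y≡c : proj₁ y ≡ c
    y≡c = trans (cong proj₁ (sym (to∘from-V y))) (φ-b (mapV from y) from-y≡b)
  ... | no from-y≢b = trans (sym y≡from-y) (sym (r-other (proj₁ y) y≢c))
    where
    y≡from-y : proj₁ y ≡ proj₁ (mapV from y)
    y≡from-y = trans (cong proj₁ (sym (to∘from-V y))) (φ-fixV (mapV from y) from-y≢b)
    y≢c : proj₁ y ≢ c
    y≢c y≡c = c∉B↑b (subst (Mem b) (trans (sym y≡from-y) y≡c) (proj₂ (mapV from y)))

  B↑-edge≡ : ∀ {x} {e e' : EG} {m : Mem x (s e) × Mem x (t e)} {m' : Mem x (s e') × Mem x (t e')} →
    e ≡ e' → _≡_ {A = Et (B↑ Sig G x)} (e , m) (e' , m')
  B↑-edge≡ {m = ms , mt} {ms' , mt'} refl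
    rewrite T-irrelevant ms ms' | T-irrelevant mt mt' = refl

  edge-in-B↑c? : (e : EG) → Dec (Mem c (s e) × Mem c (t e))
  edge-in-B↑c? e = T? _ ×-dec T? _

  rE : EG → EG
  rE e with edge-in-B↑c? e
  ... | yes m = proj₁ (mapE from (e , m))
  ... | no _ = e

  from-edge-src : ∀ e m → s (proj₁ (mapE from (e , m))) ≡ r (s e)
  from-edge-src e m = trans (cong proj₁ (sym (src-comm (hom from) (e , m)))) (from-vertex (s e , proj₁ m))

  from-edge-tgt : ∀ e m → t (proj₁ (mapE from (e , m))) ≡ r (t e)
  from-edge-tgt e m = trans (cong proj₁ (sym (tgt-comm (hom from) (e , m)))) (from-vertex (t e , proj₂ m))

  rE-src : ∀ e → r (s (rE e)) ≡ r (s e)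
  rE-src e with edge-in-B↑c? e
  ... | yes m = trans (cong r (from-edge-src e m)) (r-idempotent (s e))
  ... | no _ = refl

  rE-tgt : ∀ e → r (t (rE e)) ≡ r (t e)
  rE-tgt e with edge-in-B↑c? e
  ... | yes m = trans (cong r (from-edge-tgt e m)) (r-idempotent (t e))
  ... | no _ = refl

  rE-type : ∀ e → τE A (rE e) ≡ τE A e
  rE-type e with edge-in-B↑c? e
  ... | yes m = tyCommE from (e , m)
  ... | no _ = refl

  -- no edge in the image of rE ends at c: edges into c lie in B↑(c)
  rE-tgt≢c : ∀ e → t (rE e) ≢ c
  rE-tgt≢c e with edge-in-B↑c? e
  ... | yes m = λ eq → r≢c (t e) (trans (sym (from-edge-tgt e m)) eq)
  ... | no ¬m = λ t≡c → ¬m (in⇒mem c (s e) (inj₂ (e , refl , t≡c)) , in⇒mem c (t e) (inj₁ t≡c))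

  -- edges kept by U are outside B↑(c), hence fixed
  rE-kept : ∀ e → NotBangE Sig (τE A e) → rE e ≡ e
  rE-kept e kept with edge-in-B↑c? e
  ... | yes (_ , mt) = ⊥-elim (into-bang-deleted (τE A e)
          (trans (sym (tgt-comm (typing A) e)) (B↑-bang c (t e) c-bang (mem⇒in c (t e) mt))) kept)
  ... | no _ = refl

  -- edges of B↑(b) are outside B↑(c), hence fixed
  rE-on-B↑b : (f : Et (B↑ Sig G b)) → rE (proj₁ f) ≡ proj₁ f
  rE-on-B↑b f@(e , _) with edge-in-B↑c? e
  ... | yes m@(ms , mt) = trans (cong (λ g → proj₁ (mapE from g)) (B↑-edge≡ (sym (φ-fixE f s≢b t≢b))))
                                (cong proj₁ (from∘to-E f))
    where
    s≢b : s e ≢ b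
    s≢b s≡b = b∉B↑c (subst (Mem c) s≡b ms)
    t≢b : t e ≢ b
    t≢b t≡b = b∉B↑c (subst (Mem c) t≡b mt)
  ... | no _ = refl

  rE-on-image : (f : Et (B↑ Sig G b)) → rE (proj₁ (mapE to f)) ≡ proj₁ f
  rE-on-image f with edge-in-B↑c? (proj₁ (mapE to f))
  ... | yes m = trans (cong (λ g → proj₁ (mapE from g)) (B↑-edge≡ refl)) (cong proj₁ (from∘to-E f))
  ... | no ¬m = ⊥-elim (¬m (proj₂ (mapE to f)))

  q-b≡q-c : mapV q b ≡ mapV q c
  q-b≡q-c = trans (proj₁ (proj₁ q-coequaliser) (b , in⇒mem b b (inj₁ refl))) (cong (mapV q) (φ-b _ refl))

  q-r : ∀ x → mapV q (r x) ≡ mapV q x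
  q-r x with x ≟ c
  ... | yes refl = q-b≡q-c
  ... | no _ = refl

  q-rE : ∀ e → mapE q (rE e) ≡ mapE q e
  q-rE e with edge-in-B↑c? e
  ... | yes m = trans (proj₂ (proj₁ q-coequaliser) (mapE from (e , m))) (cong (λ g → mapE q (proj₁ g)) (to∘from-E (e , m)))
  ... | no _ = refl

  -- The explicit cocone: G with every endpoint passed through r, so that
  -- c is left isolated.
  K : Typed (𝒢T! Sig)
  K = record
    { graph = record { V = VG ; E = EG ; src = λ e → r (s e) ; tgt = λ e → r (t e) }
    ; typing = record
      { fV = τ ; fE = τE A
      ; src-comm = λ e → trans (r-type (s e)) (src-comm (typing A) e)
      ; tgt-comm = λ e → trans (r-type (t e)) (tgt-comm (typing A) e) } }

  h : THom A K
  h = record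
    { hom = record { fV = r ; fE = rE ; src-comm = λ e → sym (rE-src e) ; tgt-comm = λ e → sym (rE-tgt e) }
    ; tyCommV = r-type
    ; tyCommE = rE-type }

  h-vertex : ∀ (v : Vt (B↑ Sig G b)) → r (proj₁ v) ≡ r (proj₁ (mapV to v))
  h-vertex v with proj₁ v ≟ b
  ... | yes v≡b = trans (cong r v≡b) (trans r-b (sym (trans (cong r (φ-b v v≡b)) r-c)))
  ... | no v≢b = cong r (sym (φ-fixV v v≢b))

  h-coequalises : (h ∘H incl↑ Sig G b) ≈ (h ∘H (incl↑ Sig G c ∘H to))
  h-coequalises = h-vertex , λ f → trans (rE-on-B↑b f) (sym (rE-on-image f))

  k : THom K HA
  k = record
    { hom = record { fV = mapV q ; fE = mapE q
                   ; src-comm = λ e → trans (q-r (s e)) (src-comm (hom q) e)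
                   ; tgt-comm = λ e → trans (q-r (t e)) (tgt-comm (hom q) e) }
    ; tyCommV = tyCommV q
    ; tyCommE = tyCommE q }

  section : Σ (THom HA K) λ u → ((u ∘H q) ≈ h) × ((k ∘H u) ≈ idT HA)
  section = coequaliser-section {f = incl↑ Sig G b} {g = incl↑ Sig G c ∘H to} {q = q} q-coequaliser h h-coequalises k (q-r , q-rE)

  u : THom HA K
  u = proj₁ section

  u-q : ∀ x → mapV u (mapV q x) ≡ r x
  u-q = proj₁ (proj₁ (proj₂ section))

  u-qE : ∀ e → mapE u (mapE q e) ≡ rE e
  u-qE = proj₂ (proj₁ (proj₂ section))

  q-u : ∀ z → mapV q (mapV u z) ≡ z
  q-u = proj₁ (proj₂ (proj₂ section))

  q-uE : ∀ E → mapE q (mapE u E) ≡ E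
  q-uE = proj₂ (proj₂ (proj₂ section))

  u-fixed : ∀ z → r (mapV u z) ≡ mapV u z
  u-fixed z = trans (sym (u-q (mapV u z))) (cong (mapV u) (q-u z))

  u≢c : ∀ z → mapV u z ≢ c
  u≢c z u≡c = r≢c (mapV u z) (trans (u-fixed z) u≡c)

  uE-fixed : ∀ E → rE (mapE u E) ≡ mapE u E
  uE-fixed E = trans (sym (u-qE (mapE u E))) (cong (mapE u) (q-uE E))

  uE-tgt≢c : ∀ E → t (mapE u E) ≢ c
  uE-tgt≢c E = subst (λ e → t e ≢ c) (uE-fixed E) (rE-tgt≢c (mapE u E))

  q-identifies : ∀ x y → mapV q x ≡ mapV q y → r x ≡ r y
  q-identifies x y qx≡qy = trans (sym (u-q x)) (trans (cong (mapV u) qx≡qy) (u-q y))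

  q-respects-r : ∀ x y → r x ≡ r y → mapV q x ≡ mapV q y
  q-respects-r x y rx≡ry = trans (sym (q-r x)) (trans (cong (mapV q) rx≡ry) (q-r y))

  -- c is a !-vertex, so nothing kept by U touches it
  kept-vertex≢c : ∀ x → NotBang Sig (τ x) → x ≢ c
  kept-vertex≢c x kept refl = subst (NotBang Sig) c-bang kept

  kept-src≢c : ∀ e → NotBangE Sig (τE A e) → s e ≢ c
  kept-src≢c e kept s≡c =
    kept-src-not-bang (τE A e) kept (trans (sym (src-comm (typing A) e)) (trans (cong τ s≡c) c-bang))

  kept-tgt≢c : ∀ e → NotBangE Sig (τE A e) → t e ≢ c
  kept-tgt≢c e kept t≡c =
    kept-tgt-not-bang (τE A e) kept (trans (sym (tgt-comm (typing A) e)) (trans (cong τ t≡c) c-bang))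

  u-kept : ∀ E → NotBangE Sig (τE HA E) → NotBangE Sig (τE A (mapE u E))
  u-kept E = subst (NotBangE Sig) (sym (tyCommE u E))

  -- Merging only touches !-vertices and their edges: U(G) ≅ U(MERGE(G)).
  U-G≅U-H : U Sig A ≅ U Sig HA
  U-G≅U-H = record
    { to = U-hom (mapV q) (mapE q) (tyCommV q) (tyCommE q)
             (λ e _ → src-comm (hom q) e) (λ e _ → tgt-comm (hom q) e)
    ; from = U-hom (mapV u) (mapE u) (tyCommV u) (tyCommE u)
               (λ E kept → trans (src-comm (hom u) E) (r-other _ (kept-src≢c (mapE u E) (u-kept E kept))))
               (λ E kept → trans (tgt-comm (hom u) E) (r-other _ (kept-tgt≢c (mapE u E) (u-kept E kept))))
    ; from∘to-V = λ { (x , kept) → U-vertex≡ A (trans (u-q x) (r-other x (kept-vertex≢c x kept))) }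
    ; from∘to-E = λ { (e , kept) → U-edge≡ A (trans (u-qE e) (rE-kept e kept)) }
    ; to∘from-V = λ { (z , _) → U-vertex≡ HA (q-u z) }
    ; to∘from-E = λ { (E , _) → U-edge≡ HA (q-uE E) } }

  Lifted : (VG → VG → Set) → Vt HA → Vt HA → Set
  Lifted R z w = Σ VG λ x → Σ VG λ y → (mapV q x ≡ z) × (mapV q y ≡ w) × R x y

  q-src-u : ∀ E → mapV q (s (mapE u E)) ≡ srct HA E
  q-src-u E = trans (src-comm (hom q) (mapE u E)) (cong (srct HA) (q-uE E))

  q-tgt-u : ∀ E → mapV q (t (mapE u E)) ≡ tgtt HA E
  q-tgt-u E = trans (tgt-comm (hom q) (mapE u E)) (cong (tgtt HA) (q-uE E))

  edge-H⇒ : ∀ z w → Edge Sig H z w → Lifted (Edge Sig G) z w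
  edge-H⇒ z w (E , s≡z , t≡w) =
    s (mapE u E) , t (mapE u E) , trans (q-src-u E) s≡z , trans (q-tgt-u E) t≡w , (mapE u E , refl , refl)

  edge-H⇐ : ∀ {x y z w} → mapV q x ≡ z → mapV q y ≡ w → Edge Sig G x y → Edge Sig H z w
  edge-H⇐ qx≡z qy≡w (e , s≡x , t≡y) =
      mapE q e
    , trans (sym (src-comm (hom q) e)) (trans (cong (mapV q) s≡x) qx≡z)
    , trans (sym (tgt-comm (hom q) e)) (trans (cong (mapV q) t≡y) qy≡w)

  box-H⇒ : ∀ z w → InB Sig H z w → Lifted (InB Sig G) z w
  box-H⇒ z w (inj₁ w≡z) = mapV u z , mapV u z , q-u z , trans (q-u z) (sym w≡z) , inj₁ refl
  box-H⇒ z w (inj₂ e) with edge-H⇒ z w e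
  ... | x , y , qx≡z , qy≡w , x→y = x , y , qx≡z , qy≡w , inj₂ x→y

  box-H⇐ : ∀ {x y z w} → mapV q x ≡ z → mapV q y ≡ w → InB Sig G x y → InB Sig H z w
  box-H⇐ qx≡z qy≡w (inj₁ y≡x) = inj₁ (trans (sym qy≡w) (trans (cong (mapV q) y≡x) qx≡z))
  box-H⇐ qx≡z qy≡w (inj₂ e) = inj₂ (edge-H⇐ qx≡z qy≡w e)

  bang-reflect : ∀ {x z} → mapV q x ≡ z → IsBangV Sig H z → IsBangV Sig G x
  bang-reflect {x} refl z-bang = trans (sym (tyCommV q x)) z-bang

  reflexive-H : BangAxioms.β-Reflexive Sig H
  reflexive-H z z-bang = edge-H⇐ (q-u z) (q-u z) (reflexive-G (mapV u z) (bang-reflect (q-u z) z-bang))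

  antisymmetric-mod-r : ∀ x y x' y' → τ x ≡ bang → τ y' ≡ bang →
    Edge Sig G x y → Edge Sig G y' x' → r x ≡ r x' → r y ≡ r y' → r x ≡ r y
  antisymmetric-mod-r x y x' y' x-bang y'-bang x→y y'→x' rx≡rx' ry≡ry' with redirect x y y' x→y ry≡ry'
  ... | inj₁ rx≡ry' = trans rx≡ry' (sym ry≡ry')
  ... | inj₂ x→y' with redirect y' x' x y'→x' (sym rx≡rx')
  ...   | inj₁ ry'≡rx = trans (sym ry'≡rx) (sym ry≡ry')
  ...   | inj₂ y'→x = trans (cong r (antisymmetric-G x y' x-bang y'-bang x→y' y'→x)) (sym ry≡ry')

  antisymmetric-H : BangAxioms.β-Antisymmetric Sig H
  antisymmetric-H z w z-bang w-bang z→w w→z with edge-H⇒ z w z→w | edge-H⇒ w z w→z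
  ... | x , y , qx≡z , qy≡w , x→y | y' , x' , qy'≡w , qx'≡z , y'→x' =
    trans (sym qx≡z) (trans (q-respects-r x y (antisymmetric-mod-r x y x' y'
      (bang-reflect qx≡z z-bang) (bang-reflect qy'≡w w-bang) x→y y'→x'
      (q-identifies x x' (trans qx≡z (sym qx'≡z))) (q-identifies y y' (trans qy≡w (sym qy'≡w))))) qy≡w)

  transitive-H : BangAxioms.β-Transitive Sig H
  transitive-H z w v z-bang w-bang v-bang z→w w→v with edge-H⇒ z w z→w | edge-H⇒ w v w→v
  ... | x , y , qx≡z , qy≡w , x→y | y' , t' , qy'≡w , qt'≡v , y'→t'
    with redirect x y y' x→y (q-identifies y y' (trans qy≡w (sym qy'≡w)))
  ... | inj₁ rx≡ry' = edge-H⇐ (trans (q-respects-r y' x (sym rx≡ry')) qx≡z) qt'≡v y'→t'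
  ... | inj₂ x→y' = edge-H⇐ qx≡z qt'≡v (transitive-G x y' t'
          (bang-reflect qx≡z z-bang) (bang-reflect qy'≡w w-bang) (bang-reflect qt'≡v v-bang) x→y' y'→t')

  nested-H : BangAxioms.Boxes-Nested Sig H
  nested-H z z' z-bang z'-bang z'∈Bz W W∈Bz' with box-H⇒ z z' z'∈Bz | box-H⇒ z' W W∈Bz'
  ... | x , y , qx≡z , qy≡z' , y∈Bx | x' , y' , qx'≡z' , qy'≡W , y'∈Bx' = lift y∈Bx
    where
    ry≡rx' : r y ≡ r x'
    ry≡rx' = q-identifies y x' (trans qy≡z' (sym qx'≡z'))
    -- if x is identified with x', the box of z' is already below z
    via-x' : r x ≡ r x' → InB Sig H z W
    via-x' rx≡rx' = box-H⇐ (trans (q-respects-r x' x (sym rx≡rx')) qx≡z) qy'≡W y'∈Bx'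
    lift : InB Sig G x y → InB Sig H z W
    lift (inj₁ y≡x) = via-x' (trans (cong r (sym y≡x)) ry≡rx')
    lift (inj₂ x→y) with redirect x y x' x→y ry≡rx'
    ... | inj₁ rx≡rx' = via-x' rx≡rx'
    ... | inj₂ x→x' = box-H⇐ qx≡z qy'≡W (nested-G x x' (bang-reflect qx≡z z-bang) (bang-reflect qx'≡z' z'-bang)
                        (inj₂ x→x') y' y'∈Bx')

  unique-H : BangAxioms.β-Unique Sig H
  unique-H z w z-bang w-bang E E' s≡z t≡w s'≡z t'≡w =
    trans (sym (q-uE E)) (trans (cong (mapE q) same-rep) (q-uE E'))
    where
    e e' : EG
    e = mapE u E
    e' = mapE u E'
    qs≡z : mapV q (s e) ≡ z
    qs≡z = trans (q-src-u E) s≡z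
    rs≡rs' : r (s e) ≡ r (s e')
    rs≡rs' = q-identifies (s e) (s e') (trans qs≡z (sym (trans (q-src-u E') s'≡z)))
    -- representatives never end at c, so their targets agree on the nose
    t≡t' : t e ≡ t e'
    t≡t' = r-injective-off-c (t e) (t e') (uE-tgt≢c E) (uE-tgt≢c E')
      (q-identifies (t e) (t e') (trans (trans (q-tgt-u E) t≡w) (sym (trans (q-tgt-u E') t'≡w))))
    -- sources b and c would put t e in B(b) ∩ B(c)
    same-source : (s e ≡ s e') ⊎ ((s e ≡ b × s e' ≡ c) ⊎ (s e ≡ c × s e' ≡ b)) → e ≡ e'
    same-source (inj₁ s≡s') = unique-G (s e) (t e) (bang-reflect qs≡z z-bang)
      (bang-reflect (trans (q-tgt-u E) t≡w) w-bang) e e' refl refl (sym s≡s') (sym t≡t')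
    same-source (inj₂ (inj₁ (s≡b , s'≡c))) = ⊥-elim (disjoint (t e) (inj₂ (e , s≡b , refl) , inj₂ (e' , s'≡c , sym t≡t')))
    same-source (inj₂ (inj₂ (s≡c , s'≡b))) = ⊥-elim (disjoint (t e) (inj₂ (e' , s'≡b , sym t≡t') , inj₂ (e , s≡c , refl)))
    same-rep : e ≡ e'
    same-rep = same-source (r-fibres (s e) (s e') rs≡rs')

  r-preimage-kept : ∀ y w → NotBang Sig (τ w) → r y ≡ w → y ≡ w
  r-preimage-kept y w kept ry≡w with y ≟ c
  ... | yes _ = ⊥-elim (subst (NotBang Sig) (trans (cong τ (sym ry≡w)) b-bang) kept)
  ... | no _ = ry≡w

  u-kept-vertex : ∀ W → NotBang Sig (τV HA W) → NotBang Sig (τ (mapV u W))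
  u-kept-vertex W = subst (NotBang Sig) (sym (tyCommV u W))

  -- The box of a !-vertex z of H, on representatives: B(u z), together
  -- with B(c) when z is the merged vertex.
  MergedBox : Vt HA → VG → Set
  MergedBox z v = InB Sig G (mapV u z) v ⊎ ((mapV u z ≡ b) × InB Sig G c v)

  box-kept⇒ : ∀ z W → NotBang Sig (τV HA W) → InB Sig H z W → MergedBox z (mapV u W)
  box-kept⇒ z W kept W∈Bz with box-H⇒ z W W∈Bz
  ... | x , y , qx≡z , qy≡W , y∈Bx = by-source (r-fibres x (mapV u z) rx≡ruz)
    where
    y≡uW : y ≡ mapV u W
    y≡uW = r-preimage-kept y (mapV u W) (u-kept-vertex W kept)
      (trans (q-identifies y (mapV u W) (trans qy≡W (sym (q-u W)))) (u-fixed W))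
    rx≡ruz : r x ≡ r (mapV u z)
    rx≡ruz = q-identifies x (mapV u z) (trans qx≡z (sym (q-u z)))
    by-source : (x ≡ mapV u z) ⊎ ((x ≡ b × mapV u z ≡ c) ⊎ (x ≡ c × mapV u z ≡ b)) → MergedBox z (mapV u W)
    by-source (inj₁ x≡uz) = inj₁ (subst₂ (InB Sig G) x≡uz y≡uW y∈Bx)
    by-source (inj₂ (inj₁ (_ , uz≡c))) = ⊥-elim (u≢c z uz≡c)
    by-source (inj₂ (inj₂ (x≡c , uz≡b))) = inj₂ (uz≡b , subst₂ (InB Sig G) x≡c y≡uW y∈Bx)

  box-kept⇐ : ∀ z W → MergedBox z (mapV u W) → InB Sig H z W
  box-kept⇐ z W (inj₁ uW∈Buz) = box-H⇐ (q-u z) (q-u W) uW∈Buz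
  box-kept⇐ z W (inj₂ (uz≡b , uW∈Bc)) =
    box-H⇐ (trans (sym q-b≡q-c) (trans (cong (mapV q) (sym uz≡b)) (q-u z))) (q-u W) uW∈Bc

  -- the box of the merged vertex is the disjoint union U(B(b)) ∪ U(B(c))
  merged-box-open : ∀ z → mapV u z ≡ b → IsOpenSub Sig (U Sig HA) (UB Sig H z)
  merged-box-open z uz≡b = Transport.open-sub U-G≅U-H B-b∪B-c (UB Sig H z) to-G to-H
    (union-open (U Sig A) (UB Sig G b) (UB Sig G c) (λ w in-b in-c → disjoint (proj₁ w) (in-b , in-c))
      (open-G b b-bang) (open-G c c-bang))
    where
    B-b∪B-c : Vt (U Sig A) → Set
    B-b∪B-c w = UB Sig G b w ⊎ UB Sig G c w
    to-G : ∀ W → UB Sig H z W → B-b∪B-c (mapV (_≅_.from U-G≅U-H) W)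
    to-G (W , kept) W∈Bz with box-kept⇒ z W kept W∈Bz
    ... | inj₁ uW∈Buz = inj₁ (subst (λ x → InB Sig G x (mapV u W)) uz≡b uW∈Buz)
    ... | inj₂ (_ , uW∈Bc) = inj₂ uW∈Bc
    to-H : ∀ W → B-b∪B-c (mapV (_≅_.from U-G≅U-H) W) → UB Sig H z W
    to-H (W , _) (inj₁ uW∈Bb) = box-kept⇐ z W (inj₁ (subst (λ x → InB Sig G x (mapV u W)) (sym uz≡b) uW∈Bb))
    to-H (W , _) (inj₂ uW∈Bc) = box-kept⇐ z W (inj₂ (uz≡b , uW∈Bc))

  -- any other box is a transported box of G
  other-box-open : ∀ z → IsBangV Sig H z → mapV u z ≢ b → IsOpenSub Sig (U Sig HA) (UB Sig H z)
  other-box-open z z-bang uz≢b = Transport.open-sub U-G≅U-H (UB Sig G (mapV u z)) (UB Sig H z) to-G to-H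
    (open-G (mapV u z) (bang-reflect (q-u z) z-bang))
    where
    to-G : ∀ W → UB Sig H z W → UB Sig G (mapV u z) (mapV (_≅_.from U-G≅U-H) W)
    to-G (W , kept) W∈Bz with box-kept⇒ z W kept W∈Bz
    ... | inj₁ uW∈Buz = uW∈Buz
    ... | inj₂ (uz≡b , _) = ⊥-elim (uz≢b uz≡b)
    to-H : ∀ W → UB Sig G (mapV u z) (mapV (_≅_.from U-G≅U-H) W) → UB Sig H z W
    to-H (W , _) uW∈Buz = box-kept⇐ z W (inj₁ uW∈Buz)

  open-H : BangAxioms.Boxes-Open Sig H
  open-H z z-bang with mapV u z ≟ b
  ... | yes uz≡b = merged-box-open z uz≡b
  ... | no uz≢b = other-box-open z z-bang uz≢b

  merge-is-bang-graph : IsBangGraph Sig H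
  merge-is-bang-graph =
      Transport.string-sub U-G≅U-H (λ _ → ⊤) (λ _ → ⊤) (λ _ _ → tt) (λ _ _ → tt) string-G
    , unique-H , reflexive-H , antisymmetric-H , transitive-H , open-H , nested-H

proposition6p27 :
    (T : Signature) (G : FinTyped T) → IsBangGraph T G →
    (b c : Vt (toTyped T G)) → IsBangV T G b → IsBangV T G c →
    (∀ v → ((v ≢ b) × InB↑ T G b v) ⇔ ((v ≢ c) × InB↑ T G c v)) →
    (∀ v → ¬ (InB T G b v × InB T G c v)) →
    (φ : B↑ T G b ≅ B↑ T G c) →
    (∀ v → proj₁ v ≡ b → proj₁ (mapV (_≅_.to φ) v) ≡ c) →
    (∀ v → proj₁ v ≢ b → proj₁ (mapV (_≅_.to φ) v) ≡ proj₁ v) →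
    (∀ e → srct (toTyped T G) (proj₁ e) ≢ b → tgtt (toTyped T G) (proj₁ e) ≢ b →
       proj₁ (mapE (_≅_.to φ) e) ≡ proj₁ e) →
    (H : FinTyped T) (q : THom (toTyped T G) (toTyped T H)) →
    IsCoequaliser (incl↑ T G b) (incl↑ T G c ∘H _≅_.to φ) q →
    IsBangGraph T H × (U T (toTyped T G) ≅ U T (toTyped T H))
proposition6p27 T G (string , unique , reflexive , antisymmetric , transitive , boxes-open , boxes-nested)
  b c b-bang c-bang same-parents disjoint φ φ-b φ-fixV φ-fixE H q q-coequaliser =
    merge-is-bang-graph , U-G≅U-H
  where
  open Merge T G string unique reflexive antisymmetric transitive boxes-open boxes-nested
    b c b-bang c-bang same-parents disjoint φ φ-b φ-fixV φ-fixE H q q-coequaliser
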